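{- For every positive integer $m \equiv 0 \pmod 4$, there exists an $m$-regular graph on $2m+1$ vertices that does not contain a $5$-cycle as an induced subgraph.
   Context: A graph is $m$-regular if every vertex has degree $m$. -}

module Defs where

open import Data.Nat using (ℕ)
open import Data.Bool using (Bool; true; false; T)
open import Data.Fin using (Fin)
open import Data.List using (List; length; filterᵇ; allFin)
open import Data.Product using (Σ; _×_; ∃)
open import Relation.Binary.PropositionalEquality using (_≡_; _≢_)
open import Level using (0ℓ)

record Graph (n : ℕ) : Set where
  field
    adj   : Fin n → Fin n → Bool
    sym   : ∀ i j → adj i j ≡ adj j i
    loopless : ∀ i → adj i i ≡ false
open Graph public

neighbours : ∀ {n} → Graph n → Fin n → List (Fin n)
neighbours G i = filterᵇ (adj G i) (allFin _)

degree : ∀ {n} → Graph n → Fin n → ℕ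
degree G i = length (neighbours G i)

Regular : ∀ {n} → ℕ → Graph n → Set
Regular m G = ∀ i → degree G i ≡ m

record InducedC5 {n : ℕ} (G : Graph n) : Set where
  field
    v₀ v₁ v₂ v₃ v₄ : Fin n
    d01 : v₀ ≢ v₁
    d02 : v₀ ≢ v₂
    d03 : v₀ ≢ v₃
    d04 : v₀ ≢ v₄
    d12 : v₁ ≢ v₂
    d13 : v₁ ≢ v₃
    d14 : v₁ ≢ v₄
    d23 : v₂ ≢ v₃
    d24 : v₂ ≢ v₄
    d34 : v₃ ≢ v₄
    e01 : adj G v₀ v₁ ≡ true
    e12 : adj G v₁ v₂ ≡ true
    e23 : adj G v₂ v₃ ≡ true
    e34 : adj G v₃ v₄ ≡ true
    e40 : adj G v₄ v₀ ≡ true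
    n02 : adj G v₀ v₂ ≡ false
    n03 : adj G v₀ v₃ ≡ false
    n13 : adj G v₁ v₃ ≡ false
    n14 : adj G v₁ v₄ ≡ false
    n24 : adj G v₂ v₄ ≡ false

module Submission where

-- The graph is a blow-up of the 3 × 3 rook's graph, whose cells are adjacent
-- when they share a row or a column.  For m = 4k the corner cell (0,0) becomes
-- a single vertex and every other cell a set of k vertices; the four cells
-- adjacent to the corner become cliques, the other four independent sets, and
-- cells in a common row or column are completely joined.  A vertex sees the
-- four other cells of its row and column, k vertices each, except that the
-- corner contributes only one, plus its k − 1 cell-mates if its cell is a
-- clique; as the cliques are exactly the cells adjacent to the corner, every
-- vertex has degree 4k.  An induced 5-cycle would map to five cells, not
-- necessarily distinct, showing the same pattern in the rook's graph with loops
-- at the clique cells, and an exhaustive search over the nine cells finds none.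

open import Defs
open import Data.Nat using (ℕ; _+_; _*_; _%_; _≥_)
open import Data.Product using (Σ; _×_)
open import Relation.Binary.PropositionalEquality using (_≡_)
open import Relation.Nullary using (¬_)

open import Data.Empty using (⊥)
open import Data.Bool using (Bool; true; false; _∧_; _∨_; _xor_; not; if_then_else_)
open import Data.Bool.Properties using () renaming (_≟_ to _≟ᵇ_)
open import Data.Fin using (Fin; toℕ; zero; suc)
open import Data.Fin.Patterns using (0F; 1F; 2F)
open import Data.Fin.Properties using (_≟_; all?)
open import Data.List using (length; filterᵇ; tabulate)
open import Data.Nat.Divisibility using (divides; m%n≡0⇒n∣m)
open import Data.Product using (_,_)
open import Data.Nat.Properties using (+-comm; +-assoc; +-cancelʳ-≡; *-assoc; *-comm) renaming (_≟_ to _≟ℕ_)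
open import Function using (_∘_; id)
open import Relation.Binary.PropositionalEquality as ≡ using (_≢_; refl; cong; cong₂; subst; _≗_; module ≡-Reasoning)
open import Relation.Nullary using (Dec; does; no)
open import Relation.Nullary.Decidable using (map′; toWitness; dec-true; dec-false; does-≡; _→-dec_)
open import Relation.Unary using (Decidable)

indicator : Bool → ℕ
indicator true  = 1
indicator false = 0

count : ∀ {n} → (Fin n → Bool) → ℕ
count {ℕ.zero}  p = 0
count {ℕ.suc n} p = indicator (p zero) + count (p ∘ suc)

length-filterᵇ-tabulate : ∀ {A : Set} {n} (p : A → Bool) (f : Fin n → A) →
                          length (filterᵇ p (tabulate f)) ≡ count (p ∘ f)
length-filterᵇ-tabulate {n = ℕ.zero}  p f = refl
length-filterᵇ-tabulate {n = ℕ.suc n} p f with p (f zero)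
... | true  = cong ℕ.suc (length-filterᵇ-tabulate p (f ∘ suc))
... | false = length-filterᵇ-tabulate p (f ∘ suc)

count-cong : ∀ {n} {p q : Fin n → Bool} → p ≗ q → count p ≡ count q
count-cong {ℕ.zero}  eq = refl
count-cong {ℕ.suc n} eq = cong₂ _+_ (cong indicator (eq zero)) (count-cong (eq ∘ suc))

count-remove : ∀ {n} (x : Fin n) (q : Fin n → Bool) →
               count (λ y → not (does (x ≟ y)) ∧ q y) + indicator (q x) ≡ count q
count-remove zero    q = +-comm (count (q ∘ suc)) (indicator (q zero))
count-remove (suc x) q = begin
  indicator (q zero) + count (λ y → not (does (x ≟ y)) ∧ q (suc y)) + indicator (q (suc x))
    ≡⟨ +-assoc (indicator (q zero)) _ _ ⟩
  indicator (q zero) + (count (λ y → not (does (x ≟ y)) ∧ q (suc y)) + indicator (q (suc x)))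
    ≡⟨ cong (indicator (q zero) +_) (count-remove x (q ∘ suc)) ⟩
  indicator (q zero) + count (q ∘ suc)
    ∎
  where open ≡-Reasoning

count-+ : ∀ a b (h : ℕ → Bool) →
          count {a + b} (h ∘ toℕ) ≡ count {a} (h ∘ toℕ) + count {b} (h ∘ (a +_) ∘ toℕ)
count-+ ℕ.zero    b h = refl
count-+ (ℕ.suc a) b h = begin
  indicator (h 0) + count {a + b} (h ∘ ℕ.suc ∘ toℕ)
    ≡⟨ cong (indicator (h 0) +_) (count-+ a b (h ∘ ℕ.suc)) ⟩
  indicator (h 0) + (count {a} (h ∘ ℕ.suc ∘ toℕ) + count {b} (h ∘ ℕ.suc ∘ (a +_) ∘ toℕ))
    ≡⟨ +-assoc (indicator (h 0)) _ _ ⟨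
  indicator (h 0) + count {a} (h ∘ ℕ.suc ∘ toℕ) + count {b} (h ∘ ℕ.suc ∘ (a +_) ∘ toℕ)
    ∎
  where open ≡-Reasoning

count-periodic : ∀ d k (h : ℕ → Bool) → (∀ j → h (d + j) ≡ h j) →
                 count {k * d} (h ∘ toℕ) ≡ k * count {d} (h ∘ toℕ)
count-periodic d ℕ.zero    h periodic = refl
count-periodic d (ℕ.suc k) h periodic = begin
  count {d + k * d} (h ∘ toℕ)
    ≡⟨ count-+ d (k * d) h ⟩
  count {d} (h ∘ toℕ) + count {k * d} (h ∘ (d +_) ∘ toℕ)
    ≡⟨ cong (count {d} (h ∘ toℕ) +_) (count-cong {k * d} (periodic ∘ toℕ)) ⟩
  count {d} (h ∘ toℕ) + count {k * d} (h ∘ toℕ)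
    ≡⟨ cong (count {d} (h ∘ toℕ) +_) (count-periodic d k h periodic) ⟩
  count {d} (h ∘ toℕ) + k * count {d} (h ∘ toℕ)
    ∎
  where open ≡-Reasoning

-- R a a says whether the class of a is a clique or an independent set.
module BlowUp {C : Set} (R : C → C → Bool) (R-sym : ∀ a b → R a b ≡ R b a) where

  blowUp : ∀ {n} → (Fin n → C) → Graph n
  blowUp cls = record
    { adj      = λ x y → not (does (x ≟ y)) ∧ R (cls x) (cls y)
    ; sym      = λ x y → cong₂ (λ u v → not u ∧ v)
                           (does-≡ (x ≟ y) (map′ ≡.sym ≡.sym (y ≟ x))) (R-sym (cls x) (cls y))
    ; loopless = λ x → cong (λ u → not u ∧ R (cls x) (cls x)) (dec-true (x ≟ x) refl)
    }

  adj-blowUp : ∀ {n} (cls : Fin n → C) {x y} → x ≢ y → adj (blowUp cls) x y ≡ R (cls x) (cls y)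
  adj-blowUp cls {x} {y} x≢y = cong (λ u → not u ∧ R (cls x) (cls y)) (dec-false (x ≟ y) x≢y)

  degree-blowUp : ∀ {n} (cls : Fin n → C) x →
                  degree (blowUp cls) x + indicator (R (cls x) (cls x)) ≡ count (R (cls x) ∘ cls)
  degree-blowUp cls x = begin
    degree (blowUp cls) x + indicator (R (cls x) (cls x))
      ≡⟨ cong (_+ indicator (R (cls x) (cls x))) (length-filterᵇ-tabulate (adj (blowUp cls) x) id) ⟩
    count (adj (blowUp cls) x) + indicator (R (cls x) (cls x))
      ≡⟨ count-remove x (R (cls x) ∘ cls) ⟩
    count (R (cls x) ∘ cls)
      ∎
    where open ≡-Reasoning

  -- The classes of an induced 5-cycle need not be distinct.  The quantifiers are
  -- interleaved with the conditions so that deciding the statement prunes early.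
  C5PatternFree : Set
  C5PatternFree = ∀ c₀ c₁ → R c₀ c₁ ≡ true →
                  ∀ c₂ → R c₁ c₂ ≡ true → R c₀ c₂ ≡ false →
                  ∀ c₃ → R c₂ c₃ ≡ true → R c₀ c₃ ≡ false → R c₁ c₃ ≡ false →
                  ∀ c₄ → R c₃ c₄ ≡ true → R c₄ c₀ ≡ true → R c₁ c₄ ≡ false → R c₂ c₄ ≡ false → ⊥

  blowUp-noInducedC5 : C5PatternFree → ∀ {n} (cls : Fin n → C) → ¬ InducedC5 (blowUp cls)
  blowUp-noInducedC5 free cls c =
    free (cls v₀) (cls v₁) (class d01 e01)
         (cls v₂) (class d12 e12) (class d02 n02)
         (cls v₃) (class d23 e23) (class d03 n03) (class d13 n13)
         (cls v₄) (class d34 e34) (class (d04 ∘ ≡.sym) e40) (class d14 n14) (class d24 n24)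
    where
      open InducedC5 c
      class : ∀ {x y b} → x ≢ y → adj (blowUp cls) x y ≡ b → R (cls x) (cls y) ≡ b
      class x≢y e = ≡.trans (≡.sym (adj-blowUp cls x≢y)) e

Cell : Set
Cell = Fin 3 × Fin 3

all-cells? : ∀ {P : Cell → Set} → Decidable P → Dec (∀ a → P a)
all-cells? P? = map′ (λ f (r , c) → f r c) (λ f r c → f (r , c)) (all? λ r → all? λ c → P? (r , c))

rookPattern : Cell → Cell → Bool
rookPattern (r , c) (r′ , c′) =
  if sameRow ∧ sameColumn then does (r ≟ 0F) xor does (c ≟ 0F) else sameRow ∨ sameColumn
  where
    sameRow    = does (r ≟ r′)
    sameColumn = does (c ≟ c′)

rookPattern-sym : ∀ a b → rookPattern a b ≡ rookPattern b a
rookPattern-sym = toWitness {a? = all-cells? λ a → all-cells? λ b → rookPattern a b ≟ᵇ rookPattern b a} _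

open BlowUp rookPattern rookPattern-sym

rookPattern-C5PatternFree : C5PatternFree
rookPattern-C5PatternFree = toWitness {a? = decision} _
  where
    R = rookPattern
    decision : Dec C5PatternFree
    decision =
      all-cells? λ c₀ → all-cells? λ c₁ → R c₀ c₁ ≟ᵇ true →-dec
      all-cells? λ c₂ → R c₁ c₂ ≟ᵇ true →-dec R c₀ c₂ ≟ᵇ false →-dec
      all-cells? λ c₃ → R c₂ c₃ ≟ᵇ true →-dec R c₀ c₃ ≟ᵇ false →-dec R c₁ c₃ ≟ᵇ false →-dec
      all-cells? λ c₄ → R c₃ c₄ ≟ᵇ true →-dec R c₄ c₀ ≟ᵇ true →-dec R c₁ c₄ ≟ᵇ false →-dec R c₂ c₄ ≟ᵇ false →-dec
      no (λ ())

corner : Cell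
corner = 0F , 0F

rimCell : ℕ → Cell
rimCell 0 = 0F , 1F
rimCell 1 = 0F , 2F
rimCell 2 = 1F , 0F
rimCell 3 = 2F , 0F
rimCell 4 = 1F , 1F
rimCell 5 = 1F , 2F
rimCell 6 = 2F , 1F
rimCell 7 = 2F , 2F
rimCell (ℕ.suc (ℕ.suc (ℕ.suc (ℕ.suc (ℕ.suc (ℕ.suc (ℕ.suc (ℕ.suc j)))))))) = rimCell j

classOf : ℕ → Cell
classOf ℕ.zero    = corner
classOf (ℕ.suc j) = rimCell j

rookBlowUp : ∀ n → Graph n
rookBlowUp n = blowUp (classOf ∘ toℕ)

rimCell-count : ∀ a → count {8} (rookPattern a ∘ rimCell ∘ toℕ) ≡ 4
rimCell-count = toWitness {a? = all-cells? λ a → count {8} (rookPattern a ∘ rimCell ∘ toℕ) ≟ℕ 4} _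

rookPattern-corner : ∀ a → rookPattern a corner ≡ rookPattern a a
rookPattern-corner = toWitness {a? = all-cells? λ a → rookPattern a corner ≟ᵇ rookPattern a a} _

rookBlowUp-regular : ∀ k → Regular (k * 4) (rookBlowUp (ℕ.suc (k * 8)))
rookBlowUp-regular k x = +-cancelʳ-≡ (indicator (R a a)) _ _ (begin
  degree (rookBlowUp (ℕ.suc (k * 8))) x + indicator (R a a)
    ≡⟨ degree-blowUp (classOf ∘ toℕ) x ⟩
  indicator (R a corner) + count {k * 8} (R a ∘ rimCell ∘ toℕ)
    ≡⟨ cong (indicator (R a corner) +_) (count-periodic 8 k (R a ∘ rimCell) (λ _ → refl)) ⟩
  indicator (R a corner) + k * count {8} (R a ∘ rimCell ∘ toℕ)
    ≡⟨ cong₂ _+_ (cong indicator (rookPattern-corner a)) (cong (k *_) (rimCell-count a)) ⟩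
  indicator (R a a) + k * 4
    ≡⟨ +-comm (indicator (R a a)) (k * 4) ⟩
  k * 4 + indicator (R a a)
    ∎)
  where
    open ≡-Reasoning
    R = rookPattern
    a = classOf (toℕ x)

lemma7 : (m : ℕ) → m ≥ 1 → m % 4 ≡ 0 →
    Σ (Graph (2 * m + 1)) (λ G → Regular m G × ¬ InducedC5 G)
lemma7 m _ m%4≡0 with m%n≡0⇒n∣m m 4 m%4≡0
... | divides k refl =
  rookBlowUp (2 * (k * 4) + 1) ,
  subst (Regular (k * 4) ∘ rookBlowUp) vertices (rookBlowUp-regular k) ,
  blowUp-noInducedC5 rookPattern-C5PatternFree (classOf ∘ toℕ)
  where
    vertices : ℕ.suc (k * 8) ≡ 2 * (k * 4) + 1
    vertices = ≡.trans (cong ℕ.suc (≡.trans (≡.sym (*-assoc k 4 2)) (*-comm (k * 4) 2)))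
                       (+-comm 1 (2 * (k * 4)))
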